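{- Let $(C,\mathbf w,\mathbf p)$ be an instance of the single knapsack problem with items $1,\dots,n$ satisfying $\frac{p_1}{w_1}>\dots>\frac{p_n}{w_n}$, and let $j^*$ be its pivot element. Let $(C-w_{j^*},\mathbf w',\mathbf p')$ and $(C,\mathbf w',\mathbf p')$, with $\mathbf w'=\mathbf w|_{[n]\setminus\{j^*\}}$ and $\mathbf p'=\mathbf p|_{[n]\setminus\{j^*\}}$ (items keep their original indices), be the two subproblems obtained by including, respectively excluding, item $j^*$. Assume both subproblems are feasible and let their pivot elements be $j_1$ and $j_2$, respectively. Then $j_1<j^*<j_2$.
   Context: Single knapsack problem: items with nonnegative integer weights $w_j$ and profits $p_j$, one knapsack of capacity $C$; choose a subset of total weight at most $C$ maximizing total profit. The pivot element (critical item) of an instance whose items are listed in decreasing order of $p_j/w_j$ is the first item in this order such that the total weight of it and all preceding items exceeds the capacity. The including subproblem is feasible when $w_{j^*}\le C$. -}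

module Defs where

open import Data.Nat using (ℕ; _+_; _≤_; _<_; _*_)
open import Data.Bool using (Bool; true; false; if_then_else_; _∧_; not)
open import Data.Fin using (Fin; toℕ; _≟_)
open import Data.Fin.Properties using ()
open import Data.List using (map; allFin)
open import Data.Nat.ListAction using (sum)
open import Data.Nat using (_≤ᵇ_)
open import Relation.Nullary using (does)
open import Relation.Binary.PropositionalEquality using (_≡_)

-- A (sub)instance of the knapsack problem on items 1..n is described by the
-- original weight vector together with a mask telling which items are present
-- (items keep their original indices and their original relative order).
Mask : ℕ → Set
Mask n = Fin n → Bool

allItems : ∀ {n} → Mask n
allItems _ = true

withoutItem : ∀ {n} → Fin n → Mask n
withoutItem j i = not (does (i ≟ j))

prefixWeight : ∀ {n} → Mask n → (Fin n → ℕ) → Fin n → ℕ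
prefixWeight {n} m w j =
  sum (map (λ i → if m i ∧ (toℕ i ≤ᵇ toℕ j) then w i else 0) (allFin n))

IsPivot : ∀ {n} → Mask n → (Fin n → ℕ) → ℕ → Fin n → Set
IsPivot {n} m w C j =
  (m j ≡ true) × (C < prefixWeight m w j) ×
  (∀ (i : Fin n) → m i ≡ true → toℕ i < toℕ j → prefixWeight m w i ≤ C)
  where open import Data.Product using (_×_)

-- p_i / w_i > p_j / w_j for all i < j (weights positive), by cross-multiplication
RatiosStrictlyDecreasing : ∀ {n} → (Fin n → ℕ) → (Fin n → ℕ) → Set
RatiosStrictlyDecreasing {n} w p =
  ∀ (i j : Fin n) → toℕ i < toℕ j → p j * w i < p i * w j

module Submission where

-- Write P for the weight of the items before j*. Since j* overflows C,
-- P + w j* > C, i.e. P > C − w j*: once j* is removed, the items before j*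
-- already overflow C − w j*, so j1 < j*. With capacity C, the prefixes before
-- j* weigh no more than in the full instance, where they fit, so j2 > j*.

open import Defs
open import Data.Nat using (ℕ; _≤_; _<_; _∸_; _+_; zero; suc; _≤ᵇ_; z≤n)
open import Data.Nat.Properties
  using (≤-refl; ≤-reflexive; ≤-trans; ≤-antisym; <⇒≤; <⇒≱; ≤∧≢⇒<; ≰⇒>; ≮⇒≥; n≤1+n; 1+n≢n;
         +-mono-≤; +-identityʳ; m∸n+n≡m; ≤ᵇ-reflects-≤)
open import Data.Fin using (Fin; toℕ; _≟_; inject₁) renaming (zero to fzero; suc to fsuc)
open import Data.Fin.Properties using (toℕ-injective; toℕ-inject₁)
open import Data.Product using (_×_; _,_)
open import Data.Bool using (true; false; if_then_else_; _∧_)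
open import Data.List using ([]; _∷_; map; allFin; tabulate)
open import Data.List.Properties using (map-tabulate; map-cong)
open import Data.Nat.ListAction using (sum)
open import Relation.Nullary using (¬_; does; yes; no; contradiction)
open import Relation.Nullary.Reflects using (ofʸ; ofⁿ)
open import Relation.Binary.PropositionalEquality using (_≡_; _≢_; refl; sym; trans; cong; subst; ≢-sym)

module _ {a} {A : Set a} where

  sum-map-mono : {f g : A → ℕ} → (∀ x → f x ≤ g x) → ∀ xs → sum (map f xs) ≤ sum (map g xs)
  sum-map-mono f≤g []       = z≤n
  sum-map-mono f≤g (x ∷ xs) = +-mono-≤ (f≤g x) (sum-map-mono f≤g xs)

  sum-map-cong : {f g : A → ℕ} → (∀ x → f x ≡ g x) → ∀ xs → sum (map f xs) ≡ sum (map g xs)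
  sum-map-cong f≗g xs = cong sum (map-cong f≗g xs)

  sum-map-+ : (f g : A → ℕ) → ∀ xs → sum (map (λ x → f x + g x) xs) ≡ sum (map f xs) + sum (map g xs)
  sum-map-+ f g []       = refl
  sum-map-+ f g (x ∷ xs) rewrite sum-map-+ f g xs = +-comm-middle (f x) (g x) _ _
    where
    open import Data.Nat.Tactic.RingSolver using (solve-∀)
    +-comm-middle : ∀ a b c d → (a + b) + (c + d) ≡ (a + c) + (b + d)
    +-comm-middle = solve-∀

  sum-map-zero : {f : A → ℕ} → (∀ x → f x ≡ 0) → ∀ xs → sum (map f xs) ≡ 0
  sum-map-zero f≡0 []       = refl
  sum-map-zero f≡0 (x ∷ xs) rewrite f≡0 x = sum-map-zero f≡0 xs

indicator : ∀ {n} → (Fin n → ℕ) → Fin n → Fin n → ℕ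
indicator f j k = if does (k ≟ j) then f k else 0

sum-indicator : ∀ {n} (f : Fin n → ℕ) (j : Fin n) → sum (map (indicator f j) (allFin n)) ≡ f j
sum-indicator {n} f j = trans (cong sum (map-tabulate {n = n} (λ k → k) (indicator f j))) (go f j)
  where
  sum-tabulate-zero : ∀ m → sum (tabulate {n = m} (λ _ → 0)) ≡ 0
  sum-tabulate-zero zero    = refl
  sum-tabulate-zero (suc m) = sum-tabulate-zero m

  go : ∀ {m} (f : Fin m → ℕ) (j : Fin m) → sum (tabulate (indicator f j)) ≡ f j
  go {suc m} f fzero    rewrite sum-tabulate-zero m = +-identityʳ (f fzero)
  go {suc m} f (fsuc j) = go (λ k → f (fsuc k)) j

withoutItem-self : ∀ {n} (s : Fin n) → withoutItem s s ≡ false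
withoutItem-self s with s ≟ s
... | yes _   = refl
... | no s≢s = contradiction refl s≢s

withoutItem-≢ : ∀ {n} {s k : Fin n} → withoutItem s k ≡ true → toℕ k ≢ toℕ s
withoutItem-≢ {s = s} present k≡s
  rewrite toℕ-injective k≡s | withoutItem-self s = contradiction present λ ()

withoutItem-present : ∀ {n} {s k : Fin n} → toℕ k ≢ toℕ s → withoutItem s k ≡ true
withoutItem-present {s = s} {k} k≢s with k ≟ s
... | yes refl = contradiction refl k≢s
... | no _     = refl

prefixTerm : ∀ {n} → Mask n → (Fin n → ℕ) → Fin n → Fin n → ℕ
prefixTerm m w j k = if m k ∧ (toℕ k ≤ᵇ toℕ j) then w k else 0

module _ {n} {w : Fin n → ℕ} where

  prefixWeight-mono-mask : {m m′ : Mask n} → (∀ k → m k ≡ true → m′ k ≡ true) →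
                           ∀ j → prefixWeight m w j ≤ prefixWeight m′ w j
  prefixWeight-mono-mask {m} {m′} m⊆m′ j = sum-map-mono pointwise (allFin n)
    where
    pointwise : ∀ k → prefixTerm m w j k ≤ prefixTerm m′ w j k
    pointwise k with m k in mk
    ... | false = z≤n
    ... | true rewrite m⊆m′ k mk = ≤-refl

  prefixWeight-allItems : ∀ s → prefixWeight allItems w s ≡ prefixWeight (withoutItem s) w s + w s
  prefixWeight-allItems s = begin
    prefixWeight allItems w s
      ≡⟨ sum-map-cong pointwise (allFin n) ⟩
    sum (map (λ k → prefixTerm (withoutItem s) w s k + indicator w s k) (allFin n))
      ≡⟨ sum-map-+ (prefixTerm (withoutItem s) w s) (indicator w s) (allFin n) ⟩
    prefixWeight (withoutItem s) w s + sum (map (indicator w s) (allFin n))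
      ≡⟨ cong (prefixWeight (withoutItem s) w s +_) (sum-indicator w s) ⟩
    prefixWeight (withoutItem s) w s + w s ∎
    where
    open Relation.Binary.PropositionalEquality.≡-Reasoning
    pointwise : ∀ k → prefixTerm allItems w s k ≡ prefixTerm (withoutItem s) w s k + indicator w s k
    pointwise k with k ≟ s
    ... | no _ = sym (+-identityʳ _)
    ... | yes refl with toℕ k ≤ᵇ toℕ k | ≤ᵇ-reflects-≤ (toℕ k) (toℕ k)
    ...   | true  | _       = refl
    ...   | false | ofⁿ k≰k = contradiction ≤-refl k≰k

  prefixWeight-absent-pred : (m : Mask n) {s i : Fin n} → m s ≡ false → suc (toℕ i) ≡ toℕ s →
                             prefixWeight m w s ≡ prefixWeight m w i
  prefixWeight-absent-pred m {s} {i} absent i+1≡s = sum-map-cong pointwise (allFin n)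
    where
    i≤s : toℕ i ≤ toℕ s
    i≤s = subst (toℕ i ≤_) i+1≡s (n≤1+n (toℕ i))

    pointwise : ∀ k → prefixTerm m w s k ≡ prefixTerm m w i k
    pointwise k with m k in mk
    ... | false = refl
    ... | true with toℕ k ≤ᵇ toℕ s | ≤ᵇ-reflects-≤ (toℕ k) (toℕ s)
                  | toℕ k ≤ᵇ toℕ i | ≤ᵇ-reflects-≤ (toℕ k) (toℕ i)
    ...   | true  | _       | true  | _       = refl
    ...   | false | _       | false | _       = refl
    ...   | false | ofⁿ k≰s | true  | ofʸ k≤i = contradiction (≤-trans k≤i i≤s) k≰s
    ...   | true  | ofʸ k≤s | false | ofⁿ k≰i with toℕ-injective k≡s
      where
      k≡s : toℕ k ≡ toℕ s
      k≡s = ≤-antisym k≤s (subst (_≤ toℕ k) i+1≡s (≰⇒> k≰i))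
    ...     | refl rewrite absent = contradiction mk λ ()

prefixWeight-absent-fzero : ∀ {n} (m : Mask (suc n)) (w : Fin (suc n) → ℕ) →
                            m fzero ≡ false → prefixWeight m w fzero ≡ 0
prefixWeight-absent-fzero {n} m w absent = sum-map-zero pointwise (allFin (suc n))
  where
  pointwise : ∀ k → prefixTerm m w fzero k ≡ 0
  pointwise fzero rewrite absent = refl
  pointwise (fsuc k) with m (fsuc k)
  ... | true  = refl
  ... | false = refl

-- The predecessor of the removed item s is present and precedes the pivot.
withoutItem-pivot-prefix-≤ : ∀ {n} {w : Fin n → ℕ} {C} {s j : Fin n} →
                             IsPivot (withoutItem s) w C j → toℕ s < toℕ j →
                             prefixWeight (withoutItem s) w s ≤ C
withoutItem-pivot-prefix-≤ {suc n} {w} {C} {fzero} _ _ =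
  subst (_≤ C) (sym (prefixWeight-absent-fzero (withoutItem fzero) w (withoutItem-self (fzero {n}))))
    z≤n
withoutItem-pivot-prefix-≤ {w = w} {C} {s@(fsuc i)} (_ , _ , fits) s<j =
  subst (_≤ C) (sym (prefixWeight-absent-pred {w = w} (withoutItem s) (withoutItem-self s) i+1≡s))
    (fits (inject₁ i) (withoutItem-present i≢s) (≤-trans (≤-reflexive i+1≡s) (<⇒≤ s<j)))
  where
  i+1≡s : suc (toℕ (inject₁ i)) ≡ toℕ s
  i+1≡s = cong suc (toℕ-inject₁ i)
  i≢s : toℕ (inject₁ i) ≢ toℕ s
  i≢s i≡s = 1+n≢n (trans i+1≡s (sym i≡s))

lemma9 : (n : ℕ) (C : ℕ) (w p : Fin n → ℕ) →
         (∀ (i : Fin n) → 0 < w i) →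
         RatiosStrictlyDecreasing w p →
         (jstar j1 j2 : Fin n) →
         IsPivot allItems w C jstar →
         w jstar ≤ C →
         IsPivot (withoutItem jstar) w (C ∸ w jstar) j1 →
         IsPivot (withoutItem jstar) w C j2 →
         (toℕ j1 < toℕ jstar) × (toℕ jstar < toℕ j2)
lemma9 _ C w _ _ _ jstar j1 j2 (_ , overflows , fits) w*≤C pivot₁@(present₁ , _) (present₂ , overflows₂ , _) =
  ≤∧≢⇒< (≮⇒≥ jstar≮j1) (withoutItem-≢ present₁) ,
  ≤∧≢⇒< (≮⇒≥ j2≮jstar) (≢-sym (withoutItem-≢ present₂))
  where
  open Data.Nat.Properties.≤-Reasoning

  jstar≮j1 : ¬ toℕ jstar < toℕ j1
  jstar≮j1 jstar<j1 = <⇒≱ overflows (begin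
    prefixWeight allItems w jstar                   ≡⟨ prefixWeight-allItems jstar ⟩
    prefixWeight (withoutItem jstar) w jstar + w jstar
      ≤⟨ +-mono-≤ (withoutItem-pivot-prefix-≤ pivot₁ jstar<j1) ≤-refl ⟩
    (C ∸ w jstar) + w jstar                         ≡⟨ m∸n+n≡m w*≤C ⟩
    C                                               ∎)

  j2≮jstar : ¬ toℕ j2 < toℕ jstar
  j2≮jstar j2<jstar = <⇒≱ overflows₂
    (≤-trans (prefixWeight-mono-mask (λ _ _ → refl) j2) (fits j2 refl j2<jstar))
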